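{- The set of finite factors of $\mathbf{t}_{3/2}$, and the set of finite factors of $\mathbf{t}'$, are each closed under bit-wise complement (if $u$ is a factor then so is $\bar u$). Consequently, $\mathsf{p}_{\mathbf{t}_{3/2}}(n+1)=2\,\mathsf{p}_{\Delta(\mathbf{t}_{3/2})}(n)$ for all $n\ge0$.
   Context: Let $\mathbf{t}_{3/2}=(t_n)_{n\ge0}\in\{0,1\}^{\mathbb{N}}$ be the unique binary sequence with $t_0=0$ such that $t_{3n}=t_{3n+1}=t_{2n}$ and $t_{3n+2}=1-t_{2n+1}$ for all $n\ge0$. Let $\mathbf{t}'$ be the unique binary sequence starting with $0$ that is a fixed point of the $2$-block substitution $00\mapsto 010,\ 01\mapsto 010,\ 10\mapsto 101,\ 11\mapsto 101$ (applied to consecutive non-overlapping length-$2$ blocks). The bit-wise complement is the morphism $\bar{\cdot}$ with $\bar 0=1,\ \bar 1=0$. For an infinite word $\mathbf{x}$, $\Delta(\mathbf{x})=(x_{n+1}-x_n \bmod 2)_{n\ge0}$ is its first difference sequence, and $\mathsf{p}_{\mathbf{x}}(n)$ is the number of distinct factors of length $n$ of $\mathbf{x}$. -}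

module Defs where

open import Data.Bool using (Bool; true; false; not; _xor_)
open import Data.Nat using (ℕ; zero; suc; _+_; _*_)
open import Data.Fin using (Fin; toℕ)
open import Data.Vec using (Vec; lookup; map)
open import Data.List using (List; length)
open import Data.List.Membership.Propositional using (_∈_)
open import Data.List.Relation.Unary.Unique.Propositional using (Unique)
open import Data.Product using (Σ; ∃; _×_)
open import Function.Bundles using (_⇔_)
open import Relation.Binary.PropositionalEquality using (_≡_)

-- Infinite binary words, with 0 ↦ false and 1 ↦ true.
Word : Set
Word = ℕ → Bool

IsT32 : Word → Set
IsT32 t = (t 0 ≡ false)
        × (∀ n → t (3 * n) ≡ t (2 * n))
        × (∀ n → t (3 * n + 1) ≡ t (2 * n))
        × (∀ n → t (3 * n + 2) ≡ not (t (2 * n + 1)))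

σ : Bool → Bool → Vec Bool 3
σ false false = false Data.Vec.∷ true Data.Vec.∷ false Data.Vec.∷ Data.Vec.[]
σ false true  = false Data.Vec.∷ true Data.Vec.∷ false Data.Vec.∷ Data.Vec.[]
σ true  false = true Data.Vec.∷ false Data.Vec.∷ true Data.Vec.∷ Data.Vec.[]
σ true  true  = true Data.Vec.∷ false Data.Vec.∷ true Data.Vec.∷ Data.Vec.[]

-- x starts with 0 and is a fixed point of σ applied to consecutive
-- non-overlapping length-2 blocks: the block x(2n)x(2n+1) is replaced by
-- σ(x(2n),x(2n+1)), which occupies positions 3n,3n+1,3n+2.
IsTPrime : Word → Set
IsTPrime x = (x 0 ≡ false)
           × (∀ n (j : Fin 3) → x (3 * n + toℕ j) ≡ lookup (σ (x (2 * n)) (x (2 * n + 1))) j)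

Δ : Word → Word
Δ x n = x (suc n) xor x n

complement : ∀ {n} → Vec Bool n → Vec Bool n
complement = map not

Factor : Word → ∀ {n} → Vec Bool n → Set
Factor x {n} w = ∃ λ i → ∀ (j : Fin n) → lookup w j ≡ x (i + toℕ j)

HasComplexity : Word → ℕ → ℕ → Set
HasComplexity x n k =
  Σ (List (Vec Bool n)) λ ws →
    Unique ws × length ws ≡ k × (∀ (w : Vec Bool n) → (w ∈ ws) ⇔ Factor x w)

-- Both words satisfy a recurrence x (3m + r) = fᵣ ⊕ x (2m + aᵣ) with x 0 = 0, a₀ = a₁ = 0 and
-- a₂ ≤ 1.  Iterating it gives x (3ᵏc + j) = x j ⊕ x (2ᵏc) for j ≤ k.  As 3ᵏ is a unit modulo
-- 2ᵏ, some multiple of 2ᵏ carries a 1 (as soon as x does), so the factor of x at i reappears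
-- complemented at 3ᵏc + i.  For a complement-closed word, a factor of length n + 1 is
-- determined by its first letter and its difference word, and both first letters occur for
-- every difference factor; hence p_x (n + 1) = 2 p_{Δx} (n).

module Submission where

open import Defs
open import Data.Bool using (Bool; true; false; not; _xor_)
open import Data.Bool.Properties
  using (xor-assoc; xor-comm; xor-same; xor-identityʳ; not-distribʳ-xor; ¬-not)
  renaming (_≟_ to _≟ᵇ_)
open import Data.Fin using (Fin; toℕ; zero; suc)
open import Data.Fin.Properties using (toℕ<n)
open import Data.List using (List; []; _∷_; _++_; length; map; deduplicate; cartesianProductWith)
open import Data.List.Properties using (length-++; length-map)
open import Data.List.Membership.Propositional using (_∈_)
open import Data.List.Membership.Propositional.Properties
  using (∈-map⁺; ∈-map⁻; ∈-cartesianProductWith⁺; ∈-cartesianProductWith⁻; deduplicate-∈⇔)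
open import Data.List.Membership.Propositional.Properties.WithK using (unique∧set⇒bag)
open import Data.List.Relation.Binary.BagAndSetEquality using (∼bag⇒↭)
open import Data.List.Relation.Binary.Permutation.Propositional.Properties using (↭-length)
import Data.List.Relation.Unary.All as All
import Data.List.Relation.Unary.AllPairs as AllPairs
open import Data.List.Relation.Unary.Any using (here; there)
open import Data.List.Relation.Unary.Unique.Propositional using (Unique)
open import Data.List.Relation.Unary.Unique.Propositional.Properties using (cartesianProductWith⁺)
open import Data.List.Relation.Unary.Unique.DecPropositional.Properties using (deduplicate-!)
open import Data.Nat using (ℕ; zero; suc; _+_; _*_; _^_; _≤_; _<_; z≤n; s≤s)
open import Data.Nat.DivMod using (_divMod_; result)
open import Data.Nat.Divisibility using (_∣_; divides; 1∣_)
open import Data.Nat.Properties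
open import Data.Nat.Tactic.RingSolver using (solve-∀)
open import Data.Product using (∃; _×_; _,_; proj₁; proj₂)
open import Data.Sum using (_⊎_; inj₁; inj₂)
open import Data.Vec as Vec using (Vec; []; _∷_; head; lookup)
open import Data.Vec.Properties using (lookup-map; ≡-dec)
open import Function using (_∘_)
open import Function.Bundles using (_⇔_; mk⇔; Equivalence)
open import Relation.Nullary using (yes; no)
open import Relation.Binary.PropositionalEquality
open ≡-Reasoning

private
  variable
    n : ℕ

ComplementClosed : Word → Set
ComplementClosed x = ∀ n (u : Vec Bool n) → Factor x u → Factor x (complement u)

3^k-odd : ∀ k → ∃ λ g → 3 ^ k ≡ 2 * g + 1
3^k-odd zero = 0 , refl
3^k-odd (suc k) with 3^k-odd k
... | g , 3^k≡ = 3 * g + 1 , trans (cong (3 *_) 3^k≡) (triple-odd g)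
  where
  triple-odd : ∀ g → 3 * (2 * g + 1) ≡ 2 * (3 * g + 1) + 1
  triple-odd = solve-∀

2^k∣odd*c+1 : ∀ g k → ∃ λ c → 2 ^ k ∣ (2 * g + 1) * c + 1
2^k∣odd*c+1 g zero = 0 , 1∣ _
2^k∣odd*c+1 g (suc k) with 2^k∣odd*c+1 g k
... | c , divides d eq with d divMod 2
...   | result e zero refl = c , divides e (trans eq (even-case e (2 ^ k)))
  where
  even-case : ∀ e p → (0 + e * 2) * p ≡ e * (2 * p)
  even-case = solve-∀
...   | result e (suc zero) refl = c + 2 ^ k , divides (e + g + 1) (begin
  (2 * g + 1) * (c + 2 ^ k) + 1         ≡⟨ split g c (2 ^ k) ⟩
  ((2 * g + 1) * c + 1) + (2 * g + 1) * 2 ^ k  ≡⟨ cong (_+ (2 * g + 1) * 2 ^ k) eq ⟩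
  (1 + e * 2) * 2 ^ k + (2 * g + 1) * 2 ^ k    ≡⟨ odd-case e g (2 ^ k) ⟩
  (e + g + 1) * (2 * 2 ^ k)                   ∎)
  where
  split : ∀ g c p → (2 * g + 1) * (c + p) + 1 ≡ ((2 * g + 1) * c + 1) + (2 * g + 1) * p
  split = solve-∀
  odd-case : ∀ e g p → (1 + e * 2) * p + (2 * g + 1) * p ≡ (e + g + 1) * (2 * p)
  odd-case = solve-∀

-- Position 3m + r of the word is read from position 2m + offset a r.
offset : ℕ → Fin 3 → ℕ
offset a zero = 0
offset a (suc zero) = 0
offset a (suc (suc zero)) = a

2*q≤q*3 : ∀ q → 2 * q ≤ q * 3
2*q≤q*3 q = ≤-trans (*-monoˡ-≤ q (s≤s (s≤s (z≤n {1})))) (≤-reflexive (*-comm 3 q))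

offset-bound : ∀ {a} → a ≤ 1 → ∀ q r k → toℕ r + q * 3 ≤ suc k → 2 * q + offset a r ≤ k
offset-bound _ zero zero k _ = z≤n
offset-bound _ (suc q) zero k le = ≤-pred (≤-trans lower le)
  where
  lower : suc (2 * suc q + 0) ≤ suc q * 3
  lower = subst₂ _≤_ (shape₁ q) (shape₂ q) (+-monoʳ-≤ 3 (2*q≤q*3 q))
    where
    shape₁ : ∀ q → 3 + 2 * q ≡ suc (2 * suc q + 0)
    shape₁ = solve-∀
    shape₂ : ∀ q → 3 + q * 3 ≡ suc q * 3
    shape₂ = solve-∀
offset-bound _ q (suc zero) k (s≤s le) =
  ≤-trans (≤-reflexive (+-identityʳ (2 * q))) (≤-trans (2*q≤q*3 q) le)
offset-bound a≤1 q (suc (suc zero)) k (s≤s le) =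
  ≤-trans (+-mono-≤ (2*q≤q*3 q) a≤1) (≤-trans (≤-reflexive (+-comm (q * 3) 1)) le)

module RecurrenceClosure
  (x : Word) (x₀ : x 0 ≡ false)
  {a : ℕ} (a≤1 : a ≤ 1) (flip : Fin 3 → Bool)
  (step : ∀ m r → x (3 * m + toℕ r) ≡ flip r xor x (2 * m + offset a r))
  where

  private
    step′ : ∀ m r → x (toℕ r + m * 3) ≡ flip r xor x (2 * m + offset a r)
    step′ m r = trans (cong x (reindex (toℕ r) m)) (step m r)
      where
      reindex : ∀ r m → r + m * 3 ≡ 3 * m + r
      reindex = solve-∀

  x[3^k*c+j]≡x[j]xor[2^k*c] : ∀ k c j → j ≤ k → x (3 ^ k * c + j) ≡ x j xor x (2 ^ k * c)
  x[3^k*c+j]≡x[j]xor[2^k*c] zero c zero z≤n = trans (cong x (+-identityʳ (1 * c))) (cong (_xor x (1 * c)) (sym x₀))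
  x[3^k*c+j]≡x[j]xor[2^k*c] (suc k) c j j≤ with j divMod 3
  ... | result q r refl = begin
    x (3 * 3 ^ k * c + (toℕ r + q * 3))
      ≡⟨ cong x (regroup (3 ^ k) c q (toℕ r)) ⟩
    x (toℕ r + (3 ^ k * c + q) * 3)
      ≡⟨ step′ (3 ^ k * c + q) r ⟩
    flip r xor x (2 * (3 ^ k * c + q) + offset a r)
      ≡⟨ cong (λ i → flip r xor x i) (halve (3 ^ k) c q (offset a r)) ⟩
    flip r xor x (3 ^ k * (2 * c) + (2 * q + offset a r))
      ≡⟨ cong (flip r xor_) (x[3^k*c+j]≡x[j]xor[2^k*c] k (2 * c) _ (offset-bound a≤1 q r k j≤)) ⟩
    flip r xor (x (2 * q + offset a r) xor x (2 ^ k * (2 * c)))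
      ≡⟨ xor-assoc (flip r) _ _ ⟨
    (flip r xor x (2 * q + offset a r)) xor x (2 ^ k * (2 * c))
      ≡⟨ cong₂ _xor_ (step′ q r) (cong x (reassoc (2 ^ k) c)) ⟨
    x (toℕ r + q * 3) xor x (2 * 2 ^ k * c) ∎
    where
    regroup : ∀ p c q r → 3 * p * c + (r + q * 3) ≡ r + (p * c + q) * 3
    regroup = solve-∀
    halve : ∀ p c q s → 2 * (p * c + q) + s ≡ p * (2 * c) + (2 * q + s)
    halve = solve-∀
    reassoc : ∀ p c → 2 * p * c ≡ p * (2 * c)
    reassoc = solve-∀

  -- If 3^k c + 1 = 2^k d, then positions 2^k (j c) and 2^k (j d) carry opposite letters.
  x[2^k*c]≡true : ∀ {j} k → j ≤ k → x j ≡ true → ∃ λ c → x (2 ^ k * c) ≡ true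
  x[2^k*c]≡true {j} k j≤k xj with 3^k-odd k
  ... | g , 3^k≡ with 2^k∣odd*c+1 g k
  ... | c , divides d eq with x (2 ^ k * (j * c)) in x[jc]
  ... | true  = j * c , x[jc]
  ... | false = j * d , (begin
    x (2 ^ k * (j * d))                 ≡⟨ cong x index ⟨
    x (3 ^ k * (j * c) + j)             ≡⟨ x[3^k*c+j]≡x[j]xor[2^k*c] k (j * c) j j≤k ⟩
    x j xor x (2 ^ k * (j * c))         ≡⟨ cong₂ _xor_ xj x[jc] ⟩
    true                                ∎)
    where
    index : 3 ^ k * (j * c) + j ≡ 2 ^ k * (j * d)
    index = begin
      3 ^ k * (j * c) + j             ≡⟨ distrib (3 ^ k) j c ⟩
      j * (3 ^ k * c + 1)             ≡⟨ cong (λ o → j * (o * c + 1)) 3^k≡ ⟩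
      j * ((2 * g + 1) * c + 1)       ≡⟨ cong (j *_) eq ⟩
      j * (d * 2 ^ k)                 ≡⟨ rearrange j d (2 ^ k) ⟩
      2 ^ k * (j * d)                 ∎
      where
      distrib : ∀ t j c → t * (j * c) + j ≡ j * (t * c + 1)
      distrib = solve-∀
      rearrange : ∀ j d p → j * (d * p) ≡ p * (j * d)
      rearrange = solve-∀

  complement-occurs : ∃ (λ j → x j ≡ true) → ∀ i n → ∃ λ p → ∀ j → j < n → x (p + j) ≡ not (x (i + j))
  complement-occurs (j₁ , xj₁) i n with x[2^k*c]≡true (j₁ + (i + n)) (m≤m+n j₁ (i + n)) xj₁
  ... | c , x[c] = 3 ^ K * c + i , λ j j<n → begin
    x (3 ^ K * c + i + j)           ≡⟨ cong x (+-assoc (3 ^ K * c) i j) ⟩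
    x (3 ^ K * c + (i + j))         ≡⟨ x[3^k*c+j]≡x[j]xor[2^k*c] K c (i + j) (i+j≤K j<n) ⟩
    x (i + j) xor x (2 ^ K * c)     ≡⟨ cong (x (i + j) xor_) x[c] ⟩
    x (i + j) xor true              ≡⟨ xor-comm (x (i + j)) true ⟩
    not (x (i + j))                 ∎
    where
    K : ℕ
    K = j₁ + (i + n)
    i+j≤K : ∀ {j} → j < n → i + j ≤ K
    i+j≤K j<n = ≤-trans (+-monoʳ-≤ i (<⇒≤ j<n)) (m≤n+m (i + n) j₁)

  complementClosed : ∃ (λ j → x j ≡ true) → ComplementClosed x
  complementClosed nonzero n u (i , u≡) with complement-occurs nonzero i n
  ... | p , opposite = p , λ j → begin
    lookup (complement u) j      ≡⟨ lookup-map j not u ⟩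
    not (lookup u j)             ≡⟨ cong not (u≡ j) ⟩
    not (x (i + toℕ j))          ≡⟨ opposite (toℕ j) (toℕ<n j) ⟨
    x (p + toℕ j)                ∎

xor-cancelʳ : ∀ b a → (b xor a) xor a ≡ b
xor-cancelʳ b a = trans (xor-assoc b a a) (trans (cong (b xor_) (xor-same a)) (xor-identityʳ b))

Δᵛ : Vec Bool (suc n) → Vec Bool n
Δᵛ (a ∷ []) = []
Δᵛ (a ∷ b ∷ w) = (b xor a) ∷ Δᵛ (b ∷ w)

integrate : Bool → Vec Bool n → Vec Bool (suc n)
integrate a [] = a ∷ []
integrate a (d ∷ ds) = a ∷ integrate (d xor a) ds

head-integrate : ∀ a (d : Vec Bool n) → head (integrate a d) ≡ a
head-integrate a [] = refl
head-integrate a (_ ∷ _) = refl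

Δᵛ-integrate : ∀ a (d : Vec Bool n) → Δᵛ (integrate a d) ≡ d
Δᵛ-integrate a [] = refl
Δᵛ-integrate a (e ∷ []) = cong (_∷ []) (xor-cancelʳ e a)
Δᵛ-integrate a (e ∷ f ∷ d) = cong₂ _∷_ (xor-cancelʳ e a) (Δᵛ-integrate (e xor a) (f ∷ d))

integrate-Δᵛ : ∀ (w : Vec Bool (suc n)) → integrate (head w) (Δᵛ w) ≡ w
integrate-Δᵛ (a ∷ []) = refl
integrate-Δᵛ (a ∷ b ∷ w) =
  cong (a ∷_) (trans (cong (λ c → integrate c (Δᵛ (b ∷ w))) (xor-cancelʳ b a)) (integrate-Δᵛ (b ∷ w)))

integrate-not : ∀ a (d : Vec Bool n) → integrate (not a) d ≡ complement (integrate a d)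
integrate-not a [] = refl
integrate-not a (e ∷ d) =
  cong (not a ∷_) (trans (cong (λ c → integrate c d) (sym (not-distribʳ-xor e a))) (integrate-not (e xor a) d))

integrate-injective : ∀ {a b} {d e : Vec Bool n} → integrate a d ≡ integrate b e → a ≡ b × d ≡ e
integrate-injective {a = a} {b} {d} {e} eq =
    trans (sym (head-integrate a d)) (trans (cong head eq) (head-integrate b e))
  , trans (sym (Δᵛ-integrate a d)) (trans (cong Δᵛ eq) (Δᵛ-integrate b e))

integrate-Δᵛ-either : ∀ b (v : Vec Bool (suc n)) → integrate b (Δᵛ v) ≡ v ⊎ integrate b (Δᵛ v) ≡ complement v
integrate-Δᵛ-either b v with b ≟ᵇ head v
... | yes refl = inj₁ (integrate-Δᵛ v)
... | no b≢hv = inj₂ (begin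
  integrate b (Δᵛ v)                     ≡⟨ cong (λ c → integrate c (Δᵛ v)) (¬-not b≢hv) ⟩
  integrate (not (head v)) (Δᵛ v)        ≡⟨ integrate-not (head v) (Δᵛ v) ⟩
  complement (integrate (head v) (Δᵛ v)) ≡⟨ cong complement (integrate-Δᵛ v) ⟩
  complement v                           ∎)

Δᵛ≡⇒≡⊎≡complement : ∀ (w v : Vec Bool (suc n)) → Δᵛ w ≡ Δᵛ v → w ≡ v ⊎ w ≡ complement v
Δᵛ≡⇒≡⊎≡complement w v Δw≡Δv = subst (λ u → u ≡ v ⊎ u ≡ complement v) reconstruct (integrate-Δᵛ-either (head w) v)
  where
  reconstruct : integrate (head w) (Δᵛ v) ≡ w
  reconstruct = trans (cong (integrate (head w)) (sym Δw≡Δv)) (integrate-Δᵛ w)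

window : Word → ℕ → (n : ℕ) → Vec Bool n
window x i zero = []
window x i (suc n) = x i ∷ window x (suc i) n

lookup-window : ∀ x i n (j : Fin n) → lookup (window x i n) j ≡ x (i + toℕ j)
lookup-window x i (suc n) zero = cong x (sym (+-identityʳ i))
lookup-window x i (suc n) (suc j) = trans (lookup-window x (suc i) n j) (cong x (sym (+-suc i (toℕ j))))

window-Factor : ∀ x i n → Factor x (window x i n)
window-Factor x i n = i , lookup-window x i n

lookups≡window : ∀ x i (w : Vec Bool n) → (∀ j → lookup w j ≡ x (i + toℕ j)) → w ≡ window x i n
lookups≡window x i [] _ = refl
lookups≡window x i (a ∷ w) h = cong₂ _∷_
  (trans (h zero) (cong x (+-identityʳ i)))
  (lookups≡window x (suc i) w (λ j → trans (h (suc j)) (cong x (+-suc i (toℕ j)))))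

Factor⇒≡window : ∀ x (w : Vec Bool n) → Factor x w → ∃ λ i → w ≡ window x i n
Factor⇒≡window x w (i , h) = i , lookups≡window x i w h

Δᵛ-window : ∀ x i n → Δᵛ (window x i (suc n)) ≡ window (Δ x) i n
Δᵛ-window x i zero = refl
Δᵛ-window x i (suc n) = cong (Δ x i ∷_) (Δᵛ-window x (suc i) n)

Factor⇔Factor-Δ : ∀ x → ComplementClosed x → ∀ (w : Vec Bool (suc n)) → Factor x w ⇔ Factor (Δ x) (Δᵛ w)
Factor⇔Factor-Δ {n} x closed w = mk⇔ to from
  where
  to : Factor x w → Factor (Δ x) (Δᵛ w)
  to fw with Factor⇒≡window x w fw
  ... | i , refl = subst (Factor (Δ x)) (sym (Δᵛ-window x i n)) (window-Factor (Δ x) i n)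
  from : Factor (Δ x) (Δᵛ w) → Factor x w
  from fΔw with Factor⇒≡window (Δ x) (Δᵛ w) fΔw
  ... | i , Δw≡ with Δᵛ≡⇒≡⊎≡complement w (window x i (suc n)) (trans Δw≡ (sym (Δᵛ-window x i n)))
  ... | inj₁ refl = window-Factor x i (suc n)
  ... | inj₂ refl = closed (suc n) (window x i (suc n)) (window-Factor x i (suc n))

Enumerates : {A : Set} → (A → Set) → List A → Set
Enumerates P xs = Unique xs × (∀ a → a ∈ xs ⇔ P a)

enumeration-length : ∀ {A : Set} {P : A → Set} {xs ys} → Enumerates P xs → Enumerates P ys → length xs ≡ length ys
enumeration-length (!xs , xs⇔P) (!ys , ys⇔P) = ↭-length (∼bag⇒↭ (unique∧set⇒bag !xs !ys same-members))
  where
  same-members : ∀ {a} → a ∈ _ ⇔ a ∈ _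
  same-members {a} = mk⇔ (Equivalence.from (ys⇔P a) ∘ Equivalence.to (xs⇔P a))
                         (Equivalence.from (xs⇔P a) ∘ Equivalence.to (ys⇔P a))

bits : List Bool
bits = false ∷ true ∷ []

bits-unique : Unique bits
bits-unique = ((λ ()) All.∷ All.[]) AllPairs.∷ All.[] AllPairs.∷ AllPairs.[]

∈-bits : ∀ b → b ∈ bits
∈-bits false = here refl
∈-bits true = there (here refl)

integrations : List (Vec Bool n) → List (Vec Bool (suc n))
integrations = cartesianProductWith integrate bits

length-integrations : ∀ (ds : List (Vec Bool n)) → length (integrations ds) ≡ 2 * length ds
length-integrations ds = begin
  length (map (integrate false) ds ++ map (integrate true) ds ++ [])
    ≡⟨ length-++ (map (integrate false) ds) ⟩
  length (map (integrate false) ds) + length (map (integrate true) ds ++ [])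
    ≡⟨ cong₂ _+_ (length-map _ ds) (trans (length-++ (map (integrate true) ds)) (cong (_+ 0) (length-map _ ds))) ⟩
  length ds + (length ds + 0) ∎

differences : List (Vec Bool (suc n)) → List (Vec Bool n)
differences ws = deduplicate (≡-dec _≟ᵇ_) (map Δᵛ ws)

module _ {P : Vec Bool (suc n) → Set} {Q : Vec Bool n → Set} (P⇔Q∘Δᵛ : ∀ w → P w ⇔ Q (Δᵛ w)) where

  integrations-enumerate : ∀ {ds} → Enumerates Q ds → Enumerates P (integrations ds)
  integrations-enumerate {ds} (!ds , ds⇔Q) =
    cartesianProductWith⁺ integrate integrate-injective bits-unique !ds , λ w → mk⇔ (to w) (from w)
    where
    to : ∀ w → w ∈ integrations ds → P w
    to w w∈ with ∈-cartesianProductWith⁻ integrate bits ds w∈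
    ... | b , d , _ , d∈ , refl = Equivalence.from (P⇔Q∘Δᵛ _)
      (subst Q (sym (Δᵛ-integrate b d)) (Equivalence.to (ds⇔Q d) d∈))
    from : ∀ w → P w → w ∈ integrations ds
    from w Pw = subst (_∈ integrations ds) (integrate-Δᵛ w)
      (∈-cartesianProductWith⁺ integrate (∈-bits (head w)) (Equivalence.from (ds⇔Q _) (Equivalence.to (P⇔Q∘Δᵛ w) Pw)))

  differences-enumerate : ∀ {ws} → Enumerates P ws → Enumerates Q (differences ws)
  differences-enumerate {ws} (_ , ws⇔P) = deduplicate-! (≡-dec _≟ᵇ_) (map Δᵛ ws) , λ d → mk⇔ (to d) (from d)
    where
    to : ∀ d → d ∈ differences ws → Q d
    to d d∈ with ∈-map⁻ Δᵛ (Equivalence.from (deduplicate-∈⇔ (≡-dec _≟ᵇ_)) d∈)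
    ... | w , w∈ , refl = Equivalence.to (P⇔Q∘Δᵛ w) (Equivalence.to (ws⇔P w) w∈)
    from : ∀ d → Q d → d ∈ differences ws
    from d Qd = Equivalence.to (deduplicate-∈⇔ (≡-dec _≟ᵇ_))
      (subst (_∈ map Δᵛ ws) (Δᵛ-integrate false d) (∈-map⁺ Δᵛ (Equivalence.from (ws⇔P _)
        (Equivalence.from (P⇔Q∘Δᵛ _) (subst Q (sym (Δᵛ-integrate false d)) Qd)))))

module _ (x : Word) (closed : ComplementClosed x) where

  complexity-Δ⇒complexity : ∀ {n} m → HasComplexity (Δ x) n m → HasComplexity x (suc n) (2 * m)
  complexity-Δ⇒complexity m (ds , !ds , len , ds⇔) =
    integrations ds , proj₁ lifted , trans (length-integrations ds) (cong (2 *_) len) , proj₂ lifted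
    where
    lifted : Enumerates (Factor x) (integrations ds)
    lifted = integrations-enumerate (Factor⇔Factor-Δ x closed) (!ds , ds⇔)

  complexity⇒complexity-Δ : ∀ {n} k → HasComplexity x (suc n) k → ∃ λ m → HasComplexity (Δ x) n m × k ≡ 2 * m
  complexity⇒complexity-Δ {n} k (ws , !ws , len , ws⇔) = length ds , (ds , proj₁ dsEnum , refl , proj₂ dsEnum) , (begin
    k                          ≡⟨ len ⟨
    length ws                  ≡⟨ enumeration-length (!ws , ws⇔) (integrations-enumerate (Factor⇔Factor-Δ x closed) dsEnum) ⟩
    length (integrations ds)   ≡⟨ length-integrations ds ⟩
    2 * length ds              ∎)
    where
    ds : List (Vec Bool n)
    ds = differences ws
    dsEnum : Enumerates (Factor (Δ x)) ds
    dsEnum = differences-enumerate (Factor⇔Factor-Δ x closed) (!ws , ws⇔)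

t₃/₂-complementClosed : ∀ t → IsT32 t → ComplementClosed t
t₃/₂-complementClosed t (t₀ , t[3n] , t[3n+1] , t[3n+2]) =
  RecurrenceClosure.complementClosed t t₀ (s≤s z≤n) (lookup flips) step (2 , t₂≡true)
  where
  flips : Vec Bool 3
  flips = false ∷ false ∷ true ∷ []
  step : ∀ m r → t (3 * m + toℕ r) ≡ lookup flips r xor t (2 * m + offset 1 r)
  step m zero = trans (cong t (+-identityʳ (3 * m))) (trans (t[3n] m) (cong t (sym (+-identityʳ (2 * m)))))
  step m (suc zero) = trans (t[3n+1] m) (cong t (sym (+-identityʳ (2 * m))))
  step m (suc (suc zero)) = t[3n+2] m
  t₂≡true : t 2 ≡ true
  t₂≡true = trans (step 0 (suc (suc zero))) (cong not (trans (step 0 (suc zero)) t₀))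

t′-complementClosed : ∀ t′ → IsTPrime t′ → ComplementClosed t′
t′-complementClosed t′ (t′₀ , blocks) =
  RecurrenceClosure.complementClosed t′ t′₀ z≤n (lookup flips) step (1 , t′₁≡true)
  where
  flips : Vec Bool 3
  flips = false ∷ true ∷ false ∷ []
  σ≡flips : ∀ b c → σ b c ≡ Vec.map (_xor b) flips
  σ≡flips false false = refl
  σ≡flips false true = refl
  σ≡flips true false = refl
  σ≡flips true true = refl
  2m+offset0≡2m : ∀ m r → 2 * m + offset 0 r ≡ 2 * m
  2m+offset0≡2m m zero = +-identityʳ (2 * m)
  2m+offset0≡2m m (suc zero) = +-identityʳ (2 * m)
  2m+offset0≡2m m (suc (suc zero)) = +-identityʳ (2 * m)
  step : ∀ m r → t′ (3 * m + toℕ r) ≡ lookup flips r xor t′ (2 * m + offset 0 r)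
  step m r = begin
    t′ (3 * m + toℕ r)                              ≡⟨ blocks m r ⟩
    lookup (σ (t′ (2 * m)) (t′ (2 * m + 1))) r      ≡⟨ cong (λ v → lookup v r) (σ≡flips _ _) ⟩
    lookup (Vec.map (_xor t′ (2 * m)) flips) r      ≡⟨ lookup-map r (_xor t′ (2 * m)) flips ⟩
    lookup flips r xor t′ (2 * m)                   ≡⟨ cong (λ i → lookup flips r xor t′ i) (2m+offset0≡2m m r) ⟨
    lookup flips r xor t′ (2 * m + offset 0 r)      ∎
  t′₁≡true : t′ 1 ≡ true
  t′₁≡true = trans (step 0 (suc zero)) (cong not t′₀)

proposition15 : (t t′ : Word) → IsT32 t → IsTPrime t′ →
    (∀ n (u : Vec Bool n) → Factor t u → Factor t (complement u))
  × (∀ n (u : Vec Bool n) → Factor t′ u → Factor t′ (complement u))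
  × (∀ n →
      (∀ m → HasComplexity (Δ t) n m → HasComplexity t (suc n) (2 * m))
    × (∀ k → HasComplexity t (suc n) k →
         ∃ λ m → HasComplexity (Δ t) n m × k ≡ 2 * m))
proposition15 t t′ t-rec t′-rec =
    t-closed
  , t′-complementClosed t′ t′-rec
  , λ n → complexity-Δ⇒complexity t t-closed , complexity⇒complexity-Δ t t-closed
  where
  t-closed : ComplementClosed t
  t-closed = t₃/₂-complementClosed t t-rec
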